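{- Let $G$ be a graph, and let $G'$ be a graph obtained from $G$ by subdividing an edge. Then $\mathrm{scw}(G')\leq\mathrm{scw}(G)$.
   Context: All graphs are finite connected multigraphs (multiple edges allowed, no loops). Subdividing an edge $vw$ replaces it by a new vertex $u$ and edges $vu$, $uw$. Screewidth: a tree-cut decomposition of $G$ is a pair $(T,\mathcal{X})$ with $T$ a tree (vertices = nodes, edges = links) and $\mathcal{X}=\{X_b: b\in V(T)\}$ pairwise disjoint, possibly empty subsets of $V(G)$ (bags) with union $V(G)$. For a link $l$, $\mathrm{adh}(l)$ is the set of edges of $G$ with endpoints in bags $X_b,X_d$ where $b,d$ lie in different components of $T-l$; for a node $b$, $\mathrm{adh}(b)$ is the set of edges of $G$ with endpoints in bags $X_c,X_d$ where $c,d$ lie in different components of $T-b$. The width is $\max\{\max_l|\mathrm{adh}(l)|,\ \max_b(|X_b|+|\mathrm{adh}(b)|)\}$, and $\mathrm{scw}(G)$ is the minimum width over all tree-cut decompositions of $G$. -}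

module Defs where

open import Data.Nat using (ℕ; zero; suc; _+_; _⊔_; _≤_)
open import Data.Fin using (Fin; zero; suc; fromℕ; inject₁; _≟_)
open import Data.Bool using (Bool; true; false; _∨_; _∧_; not; if_then_else_)
open import Data.Product using (Σ; _×_; _,_; proj₁; proj₂)
open import Relation.Nullary using (¬_; does; yes; no)
open import Relation.Binary.PropositionalEquality using (_≡_; _≢_; refl; sym; cong)

-- Finite multigraphs (multiple edges allowed, no loops).
-- Vertices are Fin n, edges are Fin m, and each edge has an (ordered,
-- but the orientation is irrelevant) pair of distinct endpoints.

record Multigraph : Set where
  field
    n      : ℕ
    m      : ℕ
    ends   : Fin m → Fin n × Fin n
    noLoop : (e : Fin m) → proj₁ (ends e) ≢ proj₂ (ends e)
open Multigraph public

data Walk (G : Multigraph) : Fin (n G) → Fin (n G) → Set where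
  here : ∀ {u} → Walk G u u
  fwd  : ∀ {v} (e : Fin (m G)) → Walk G (proj₁ (ends G e)) v → Walk G (proj₂ (ends G e)) v
  bwd  : ∀ {v} (e : Fin (m G)) → Walk G (proj₂ (ends G e)) v → Walk G (proj₁ (ends G e)) v

Connected : Multigraph → Set
Connected G = (u v : Fin (n G)) → Walk G u v

IsTree : Multigraph → Set
IsTree T = Connected T × (suc (m T) ≡ n T)

anyF : ∀ {k} → (Fin k → Bool) → Bool
anyF {zero}  p = false
anyF {suc k} p = p zero ∨ anyF (λ i → p (suc i))

countF : ∀ {k} → (Fin k → Bool) → ℕ
countF {zero}  p = 0
countF {suc k} p = (if p zero then 1 else 0) + countF (λ i → p (suc i))

maxF : ∀ {k} → (Fin k → ℕ) → ℕ
maxF {zero}  f = 0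
maxF {suc k} f = f zero ⊔ maxF (λ i → f (suc i))

eqB : ∀ {k} → Fin k → Fin k → Bool
eqB i j = does (i ≟ j)

-- Reachability in the subgraph of T consisting of the edges satisfying
-- 'allowed': 'reachSet T allowed f a v' is true iff v can be reached
-- from a by a walk of length ≤ f using allowed edges only.

reachSet : (T : Multigraph) → (Fin (m T) → Bool) → ℕ → Fin (n T) → Fin (n T) → Bool
reachSet T allowed zero    a v = eqB a v
reachSet T allowed (suc f) a v =
  reachSet T allowed f a v ∨
  anyF (λ e → allowed e ∧
    ((reachSet T allowed f a (proj₁ (ends T e)) ∧ eqB (proj₂ (ends T e)) v) ∨
     (reachSet T allowed f a (proj₂ (ends T e)) ∧ eqB (proj₁ (ends T e)) v)))

-- Same component of the subgraph (walks of length ≤ |V(T)| suffice).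
sameComp : (T : Multigraph) → (Fin (m T) → Bool) → Fin (n T) → Fin (n T) → Bool
sameComp T allowed a b = reachSet T allowed (n T) a b

sameCompMinusLink : (T : Multigraph) → Fin (m T) → Fin (n T) → Fin (n T) → Bool
sameCompMinusLink T l = sameComp T (λ e → not (eqB e l))

diffCompMinusNode : (T : Multigraph) → Fin (n T) → Fin (n T) → Fin (n T) → Bool
diffCompMinusNode T b c d =
  not (eqB c b) ∧ not (eqB d b) ∧
  not (sameComp T (λ e → not (eqB (proj₁ (ends T e)) b) ∧ not (eqB (proj₂ (ends T e)) b)) c d)

-- Tree-cut decompositions.  The pairwise disjoint bags with union V(G)
-- are given by the map 'bag' sending each vertex of G to the unique node
-- whose bag contains it: X_b = { v | bag v ≡ b }.

record TreeCutDecomposition (G : Multigraph) : Set where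
  field
    T      : Multigraph
    isTree : IsTree T
    bag    : Fin (n G) → Fin (n T)
open TreeCutDecomposition public

module _ {G : Multigraph} (D : TreeCutDecomposition G) where
  private
    TT = T D
    bagOf₁ : Fin (m G) → Fin (n TT)
    bagOf₁ e = bag D (proj₁ (ends G e))
    bagOf₂ : Fin (m G) → Fin (n TT)
    bagOf₂ e = bag D (proj₂ (ends G e))

  adhLink : Fin (m TT) → ℕ
  adhLink l = countF (λ e → not (sameCompMinusLink TT l (bagOf₁ e) (bagOf₂ e)))

  adhNode : Fin (n TT) → ℕ
  adhNode b = countF (λ e → diffCompMinusNode TT b (bagOf₁ e) (bagOf₂ e))

  bagSize : Fin (n TT) → ℕ
  bagSize b = countF (λ v → eqB (bag D v) b)

  width : ℕ
  width = maxF adhLink ⊔ maxF (λ b → bagSize b + adhNode b)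

IsScw : Multigraph → ℕ → Set
IsScw G k = Σ (TreeCutDecomposition G) (λ D → width D ≡ k)
          × ((D : TreeCutDecomposition G) → k ≤ width D)

-- Subdividing edge e = vw (v = proj₁ (ends G e), w = proj₂ (ends G e)):
-- the new vertex u is 'zero', old vertices x are renamed 'suc x'; the new
-- edge uw is edge 'zero', old edges f are renamed 'suc f', where edge
-- 'suc e' now joins v and u; all other edges are unchanged.

private
  sucPair : ∀ {k} → Fin k × Fin k → Fin (suc k) × Fin (suc k)
  sucPair (a , b) = suc a , suc b

  sucNoLoop : ∀ {k} (a b : Fin k) → a ≢ b → suc a ≢ suc b
  sucNoLoop a b ne refl = ne refl

subdivide : (G : Multigraph) → Fin (m G) → Multigraph
subdivide G e = record { n = suc (n G) ; m = suc (m G) ; ends = E ; noLoop = NL }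
  where
  E : Fin (suc (m G)) → Fin (suc (n G)) × Fin (suc (n G))
  E zero    = zero , suc (proj₂ (ends G e))
  E (suc f) with f ≟ e
  ... | yes _ = suc (proj₁ (ends G e)) , zero
  ... | no _  = suc (proj₁ (ends G f)) , suc (proj₂ (ends G f))
  NL : (f : Fin (suc (m G))) → proj₁ (E f) ≢ proj₂ (E f)
  NL zero ()
  NL (suc f) with f ≟ e
  ... | yes _ = λ ()
  ... | no _  = sucNoLoop _ _ (noLoop G f)

module Submission where

-- Let e = vw and let D be a tree-cut decomposition of G.  If v and w lie in the same bag
-- X_b, put the new vertex u into a new leaf hanging off b: only uv and uw cross the new
-- link, the new node costs 1, and both are at most |X_b| ≥ 2; every other link and node
-- cuts uv or uw only where it cut vw.  Otherwise, T being a tree, some link l separates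
-- the bags of v and w; subdivide l and put u into the new node.  An old link or node that
-- cut vw now cuts at most one of uv, uw, and one that did not cut vw cuts neither; the two
-- halves of l are cut by adh(l) with vw replaced by uv or uw, and the new node costs
-- 1 + |adh(l) ∖ {vw}|.  So no part of the width grows.

open import Defs hiding (T)
open import Data.Bool using (Bool; true; false; _∧_; not; T; if_then_else_)
open import Data.Bool.Properties using (T-∧; T-∨)
open import Data.Empty using (⊥-elim)
open import Data.Fin using (Fin; zero; suc; _≟_)
open import Data.Fin.Properties using (suc-injective)
open import Data.Nat using (ℕ; zero; suc; _+_; _∸_; _≤_; _<_; z≤n; s≤s)
open import Data.Nat.Properties
  using (≤-refl; ≤-trans; <-≤-trans; <-irrefl; m≤n⇒m≤1+n; n≤1+n; m≤m+n; m≤n+m; +-assoc; +-comm; +-suc;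
         +-mono-≤; +-monoˡ-≤; +-monoʳ-≤; +-monoʳ-<; +-cancelʳ-≤; m∸n+n≡m; m≤m⊔n; m≤n⊔m; ⊔-lub; module ≤-Reasoning)
open import Data.Nat.Tactic.RingSolver using (solve-∀)
open import Data.Product using (Σ; ∃-syntax; _×_; _,_; proj₁; proj₂)
open import Data.Sum using (_⊎_; inj₁; inj₂)
import Data.Sum
open import Data.Unit using (tt)
open import Function using (_∘_)
open import Function.Bundles using (module Equivalence)
open Equivalence using (to; from)
open import Relation.Binary.Construct.Closure.ReflexiveTransitive
  using (Star; ε; _◅_; _◅◅_; return; reverse; gmap; kleisliStar)
open import Relation.Binary.PropositionalEquality using (_≡_; _≢_; refl; sym; trans; cong; subst; subst₂)
open import Relation.Nullary using (¬_; yes; no)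
open import Relation.Nullary.Decidable using (T?)
open import Relation.Unary using (_∩_; _⊆_; U)

private
  variable
    k : ℕ

eqB-refl : (a : Fin k) → T (eqB a a)
eqB-refl a with a ≟ a
... | yes _ = tt
... | no a≢a = a≢a refl

eqB-sound : {a b : Fin k} → T (eqB a b) → a ≡ b
eqB-sound {a = a} {b} t with a ≟ b
... | yes a≡b = a≡b

eqB-≢ : {a b : Fin k} → a ≢ b → T (not (eqB a b))
eqB-≢ {a = a} {b} a≢b with a ≟ b
... | yes a≡b = a≢b a≡b
... | no _ = tt

not-eqB-sound : {a b : Fin k} → T (not (eqB a b)) → a ≢ b
not-eqB-sound {a = a} t refl with a ≟ a
... | yes _ = t
... | no a≢a = a≢a refl

eqB-complete : {a b : Fin k} → ¬ T (not (eqB a b)) → a ≡ b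
eqB-complete {a = a} {b} ¬t with a ≟ b
... | yes a≡b = a≡b
... | no _ = ⊥-elim (¬t tt)

anyF-intro : (p : Fin k → Bool) (i : Fin k) → T (p i) → T (anyF p)
anyF-intro p zero t = from T-∨ (inj₁ t)
anyF-intro p (suc i) t = from T-∨ (inj₂ (anyF-intro (λ j → p (suc j)) i t))

anyF-elim : (p : Fin k → Bool) → T (anyF p) → ∃[ i ] T (p i)
anyF-elim {suc k} p t with to T-∨ t
... | inj₁ t₀ = zero , t₀
... | inj₂ t₁ with anyF-elim (λ j → p (suc j)) t₁
...   | i , tᵢ = suc i , tᵢ

T-not⇒¬T : ∀ {b} → T (not b) → ¬ T b
T-not⇒¬T {false} _ ()

¬T⇒T-not : ∀ {b} → ¬ T b → T (not b)
¬T⇒T-not {false} _ = tt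
¬T⇒T-not {true} ¬t = ¬t tt

-- Counting

bit : Bool → ℕ
bit b = if b then 1 else 0

bit-mono : ∀ {a b} → (T a → T b) → bit a ≤ bit b
bit-mono {false} _ = z≤n
bit-mono {true} {true} _ = ≤-refl
bit-mono {true} {false} a⇒b = ⊥-elim (a⇒b tt)

countF-mono : (p q : Fin k → Bool) → (∀ i → T (p i) → T (q i)) → countF p ≤ countF q
countF-mono {zero} p q p⇒q = z≤n
countF-mono {suc k} p q p⇒q =
  +-mono-≤ (bit-mono (p⇒q zero)) (countF-mono (λ i → p (suc i)) (λ i → q (suc i)) (λ i → p⇒q (suc i)))

bit-≤-1 : (b : Bool) → bit b ≤ 1
bit-≤-1 false = z≤n
bit-≤-1 true = ≤-refl

countF-true : countF {k} (λ _ → true) ≡ k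
countF-true {zero} = refl
countF-true {suc k} = cong suc (countF-true {k})

countF-false : countF {k} (λ _ → false) ≡ 0
countF-false {zero} = refl
countF-false {suc k} = countF-false {k}

countF-≤ : (p : Fin k → Bool) → countF p ≤ k
countF-≤ {k} p = subst (countF p ≤_) countF-true (countF-mono p (λ _ → true) (λ _ _ → tt))

countF-all : (p : Fin k → Bool) → (∀ i → T (p i)) → k ≤ countF p
countF-all {k} p all = subst (_≤ countF p) countF-true (countF-mono (λ _ → true) p (λ i _ → all i))

countF-pos : (p : Fin k → Bool) (i : Fin k) → T (p i) → 1 ≤ countF p
countF-pos p zero t with p zero
... | true = s≤s z≤n
countF-pos p (suc i) t = ≤-trans (countF-pos (λ j → p (suc j)) i t) (m≤n+m _ (bit (p zero)))

countF-two : (p : Fin k → Bool) {i j : Fin k} → i ≢ j → T (p i) → T (p j) → 2 ≤ countF p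
countF-two p {zero} {zero} i≢j _ _ = ⊥-elim (i≢j refl)
countF-two p {zero} {suc j} _ tᵢ tⱼ with p zero
... | true = s≤s (countF-pos (λ x → p (suc x)) j tⱼ)
countF-two p {suc i} {zero} _ tᵢ tⱼ with p zero
... | true = s≤s (countF-pos (λ x → p (suc x)) i tᵢ)
countF-two p {suc i} {suc j} i≢j tᵢ tⱼ =
  ≤-trans (countF-two (λ x → p (suc x)) (λ i≡j → i≢j (cong suc i≡j)) tᵢ tⱼ) (m≤n+m _ (bit (p zero)))

countF-< : (p q : Fin k → Bool) → (∀ i → T (p i) → T (q i)) → (i : Fin k) → T (q i) → ¬ T (p i)
         → countF p < countF q
countF-< p q p⇒q zero tq ¬tp with p zero | q zero
... | false | true = s≤s (countF-mono _ _ (λ i → p⇒q (suc i)))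
... | true | _ = ⊥-elim (¬tp tt)
countF-< p q p⇒q (suc i) tq ¬tp = begin-strict
  bit (p zero) + countF p′ <⟨ +-monoʳ-< (bit (p zero)) (countF-< p′ q′ (λ j → p⇒q (suc j)) i tq ¬tp) ⟩
  bit (p zero) + countF q′ ≤⟨ +-monoˡ-≤ (countF q′) (bit-mono (p⇒q zero)) ⟩
  bit (q zero) + countF q′ ∎
  where
  open ≤-Reasoning
  p′ q′ : Fin _ → Bool
  p′ j = p (suc j)
  q′ j = q (suc j)

countF-<-size : (p : Fin k → Bool) (i : Fin k) → ¬ T (p i) → countF p < k
countF-<-size p i ¬tp = ≤-trans (countF-< p (λ _ → true) (λ _ _ → tt) i tt ¬tp) (countF-≤ (λ _ → true))

countF-except : (p q : Fin k → Bool) (e : Fin k) → (∀ i → i ≢ e → T (p i) → T (q i))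
              → countF p + bit (q e) ≤ countF q + bit (p e)
countF-except p q zero p⇒q = begin
  bit (p zero) + countF p′ + bit (q zero) ≡⟨ swap (bit (p zero)) (countF p′) (bit (q zero)) ⟩
  bit (q zero) + countF p′ + bit (p zero) ≤⟨ +-monoˡ-≤ (bit (p zero)) (+-monoʳ-≤ (bit (q zero)) p′≤q′) ⟩
  bit (q zero) + countF q′ + bit (p zero) ∎
  where
  open ≤-Reasoning
  p′ q′ : Fin _ → Bool
  p′ j = p (suc j)
  q′ j = q (suc j)
  p′≤q′ : countF p′ ≤ countF q′
  p′≤q′ = countF-mono p′ q′ (λ j → p⇒q (suc j) (λ ()))
  swap : ∀ a b c → a + b + c ≡ c + b + a
  swap = solve-∀
countF-except p q (suc e) p⇒q = begin
  bit (p zero) + countF p′ + bit (q′ e)   ≡⟨ +-assoc (bit (p zero)) _ _ ⟩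
  bit (p zero) + (countF p′ + bit (q′ e)) ≤⟨ +-mono-≤ (bit-mono (p⇒q zero (λ ())))
                                               (countF-except p′ q′ e (λ j j≢e → p⇒q (suc j) (λ { refl → j≢e refl }))) ⟩
  bit (q zero) + (countF q′ + bit (p′ e)) ≡⟨ +-assoc (bit (q zero)) _ _ ⟨
  bit (q zero) + countF q′ + bit (p′ e)   ∎
  where
  open ≤-Reasoning
  p′ q′ : Fin _ → Bool
  p′ j = p (suc j)
  q′ j = q (suc j)

countF-≤-suc : (p q : Fin k → Bool) (e : Fin k) → (∀ i → i ≢ e → T (p i) → T (q i))
             → countF p ≤ suc (countF q)
countF-≤-suc p q e p⇒q = begin
  countF p                ≤⟨ m≤m+n (countF p) (bit (q e)) ⟩
  countF p + bit (q e)    ≤⟨ countF-except p q e p⇒q ⟩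
  countF q + bit (p e)    ≤⟨ +-monoʳ-≤ (countF q) (bit-≤-1 (p e)) ⟩
  countF q + 1            ≡⟨ +-comm (countF q) 1 ⟩
  suc (countF q)          ∎
  where open ≤-Reasoning

-- Reachability

data Joins (G : Multigraph) (f : Fin (m G)) (a b : Fin (n G)) : Set where
  forward  : ends G f ≡ (a , b) → Joins G f a b
  backward : ends G f ≡ (b , a) → Joins G f a b

Joins-sym : ∀ {G f a b} → Joins G f a b → Joins G f b a
Joins-sym (forward e) = backward e
Joins-sym (backward e) = forward e

record Step (G : Multigraph) (P : Fin (m G) → Set) (a b : Fin (n G)) : Set where
  constructor step
  field
    edge    : Fin (m G)
    permits : P edge
    joins   : Joins G edge a b

Reach : (G : Multigraph) → (Fin (m G) → Set) → Fin (n G) → Fin (n G) → Set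
Reach G P = Star (Step G P)

module _ {G : Multigraph} {P : Fin (m G) → Set} where

  Reach-sym : ∀ {a b} → Reach G P a b → Reach G P b a
  Reach-sym = reverse λ (step f pf j) → step f pf (Joins-sym j)

  Reach-≡ : ∀ {a b} → a ≡ b → Reach G P a b
  Reach-≡ refl = ε

  Reach-mono : ∀ {Q : Fin (m G) → Set} → P ⊆ Q → ∀ {a b} → Reach G P a b → Reach G Q a b
  Reach-mono P⊆Q ε = ε
  Reach-mono P⊆Q (step f pf j ◅ r) = step f (P⊆Q pf) j ◅ Reach-mono P⊆Q r

  Reach-along : ∀ {f a b} → Joins G f a b → Reach G P (proj₁ (ends G f)) (proj₂ (ends G f)) → Reach G P a b
  Reach-along (forward refl) r = r
  Reach-along (backward refl) r = Reach-sym r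

  Reach-ends : ∀ {f a b} → Joins G f a b → Reach G P a b → Reach G P (proj₁ (ends G f)) (proj₂ (ends G f))
  Reach-ends (forward refl) r = r
  Reach-ends (backward refl) r = Reach-sym r

Walk⇒Reach : ∀ {G a b} → Walk G a b → Reach G U a b
Walk⇒Reach here = ε
Walk⇒Reach (fwd e w) = step e tt (backward refl) ◅ Walk⇒Reach w
Walk⇒Reach (bwd e w) = step e tt (forward refl) ◅ Walk⇒Reach w

Reach⇒Walk : ∀ {G P a b} → Reach G P a b → Walk G a b
Reach⇒Walk ε = here
Reach⇒Walk (step f _ (forward refl) ◅ r) = bwd f (Reach⇒Walk r)
Reach⇒Walk (step f _ (backward refl) ◅ r) = fwd f (Reach⇒Walk r)

Avoids : (G : Multigraph) → Fin (n G) → Fin (m G) → Set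
Avoids G x f = proj₁ (ends G f) ≢ x × proj₂ (ends G f) ≢ x

ReachesEndOf : (G : Multigraph) → (Fin (m G) → Set) → Fin (m G) → Fin (n G) → Set
ReachesEndOf G P l a = Reach G P a (proj₁ (ends G l)) ⊎ Reach G P a (proj₂ (ends G l))

module _ {G : Multigraph} where

  Joins-Avoids : ∀ {f a b x} → Joins G f a b → Avoids G x f → a ≢ x × b ≢ x
  Joins-Avoids (forward refl) (p≢x , q≢x) = p≢x , q≢x
  Joins-Avoids (backward refl) (p≢x , q≢x) = q≢x , p≢x

  Avoids-Joins : ∀ {f a b x} → Joins G f a b → a ≢ x → b ≢ x → Avoids G x f
  Avoids-Joins (forward refl) a≢x b≢x = a≢x , b≢x
  Avoids-Joins (backward refl) a≢x b≢x = b≢x , a≢x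

  Reach-Avoids-≢ : ∀ {x a c} → Reach G (Avoids G x) a c → a ≢ x → c ≢ x
  Reach-Avoids-≢ ε a≢x = a≢x
  Reach-Avoids-≢ (step f av j ◅ r) a≢x = Reach-Avoids-≢ r (proj₂ (Joins-Avoids j av))

  module _ {P : Fin (m G) → Set} where

    first-use : ∀ l {a c} → Reach G P a c → Reach G (P ∩ (_≢ l)) a c ⊎ ReachesEndOf G (P ∩ (_≢ l)) l a
    first-use l ε = inj₁ ε
    first-use l (step f pf j ◅ r) with f ≟ l
    ... | yes refl = inj₂ (from-ends j)
      where
      from-ends : ∀ {a b} → Joins G l a b → ReachesEndOf G (P ∩ (_≢ l)) l a
      from-ends (forward refl) = inj₁ ε
      from-ends (backward refl) = inj₂ ε
    ... | no f≢l with first-use l r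
    ...   | inj₁ r′ = inj₁ (step f (pf , f≢l) j ◅ r′)
    ...   | inj₂ (inj₁ r′) = inj₂ (inj₁ (step f (pf , f≢l) j ◅ r′))
    ...   | inj₂ (inj₂ r′) = inj₂ (inj₂ (step f (pf , f≢l) j ◅ r′))

    first-visit : ∀ x {a c} → a ≢ x → Reach G P a c
                → Reach G (P ∩ Avoids G x) a c ⊎ ∃[ y ] Reach G (P ∩ Avoids G x) a y × Step G P y x
    first-visit x a≢x ε = inj₁ ε
    first-visit x {a} a≢x (_◅_ {j = b} (step f pf j) r) with b ≟ x
    ... | yes refl = inj₂ (a , ε , step f pf j)
    ... | no b≢x with first-visit x b≢x r
    ...   | inj₁ r′ = inj₁ (step f (pf , Avoids-Joins j a≢x b≢x) j ◅ r′)
    ...   | inj₂ (y , r′ , s) = inj₂ (y , step f (pf , Avoids-Joins j a≢x b≢x) j ◅ r′ , s)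

    first-visit-end : ∀ x l {a} → a ≢ x → ReachesEndOf G P l a
                    → ReachesEndOf G (P ∩ Avoids G x) l a ⊎ Reach G P a x
    first-visit-end x l a≢x (inj₁ r) with first-visit x a≢x r
    ... | inj₁ r′ = inj₁ (inj₁ r′)
    ... | inj₂ (_ , r′ , s) = inj₂ (Reach-mono proj₁ r′ ◅◅ return s)
    first-visit-end x l a≢x (inj₂ r) with first-visit x a≢x r
    ... | inj₁ r′ = inj₁ (inj₂ r′)
    ... | inj₂ (_ , r′ , s) = inj₂ (Reach-mono proj₁ r′ ◅◅ return s)

module _ (G : Multigraph) (allowed : Fin (m G) → Bool) where

  private
    Allowed : Fin (m G) → Set
    Allowed f = T (allowed f)

  reachSet-step : ∀ r {a b c} g → T (reachSet G allowed r a b) → Allowed g → Joins G g b c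
                → T (reachSet G allowed (suc r) a c)
  reachSet-step r {a} {b} {c} g tb tg j = from T-∨ (inj₂ (anyF-intro _ g (from T-∧ (tg , from T-∨ (ends-cases j)))))
    where
    R = reachSet G allowed r a
    ends-cases : Joins G g b c → T (R (proj₁ (ends G g)) ∧ eqB (proj₂ (ends G g)) c)
                               ⊎ T (R (proj₂ (ends G g)) ∧ eqB (proj₁ (ends G g)) c)
    ends-cases (forward e) rewrite e = inj₁ (from T-∧ (tb , eqB-refl c))
    ends-cases (backward e) rewrite e = inj₂ (from T-∧ (tb , eqB-refl c))

  reachSet-suc-elim : ∀ r {a c} → T (reachSet G allowed (suc r) a c)
    → T (reachSet G allowed r a c) ⊎ ∃[ g ] ∃[ b ] Allowed g × Joins G g b c × T (reachSet G allowed r a b)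
  reachSet-suc-elim r {a} {c} t with to T-∨ t
  ... | inj₁ tc = inj₁ tc
  ... | inj₂ tg with anyF-elim _ tg
  ...   | g , tj with to T-∧ tj
  ...     | ag , tj′ with to T-∨ tj′
  ...       | inj₁ t₁ with to T-∧ t₁
  ...         | tb , te = inj₂ (g , _ , ag , forward (cong (_ ,_) (eqB-sound te)) , tb)
  reachSet-suc-elim r t | inj₂ _ | g , _ | ag , _ | inj₂ t₂ with to T-∧ t₂
  ...         | tb , te = inj₂ (g , _ , ag , backward (cong (_, _) (eqB-sound te)) , tb)

  reachSet-sound : ∀ r {a c} → T (reachSet G allowed r a c) → Reach G Allowed a c
  reachSet-sound zero {a} {c} t = Reach-≡ (eqB-sound t)
  reachSet-sound (suc r) t with reachSet-suc-elim r t
  ... | inj₁ tc = reachSet-sound r tc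
  ... | inj₂ (g , _ , ag , j , tb) = reachSet-sound r tb ◅◅ return (step g ag j)

  reachSet-extend : ∀ r {a b c} → T (reachSet G allowed r a b) → Reach G Allowed b c
                  → ∃[ s ] T (reachSet G allowed s a c)
  reachSet-extend r tb ε = r , tb
  reachSet-extend r tb (step g ag j ◅ rest) = reachSet-extend (suc r) (reachSet-step r g tb ag j) rest

  -- sameComp runs n G rounds: the reach sets grow strictly until they stabilise and never
  -- exceed n G elements.
  module Stabilisation (a : Fin (n G)) where

    R : ℕ → Fin (n G) → Bool
    R r = reachSet G allowed r a

    Stable : ℕ → Set
    Stable r = ∀ v → T (R (suc r) v) → T (R r v)

    R-suc : ∀ r v → T (R r v) → T (R (suc r) v)
    R-suc r v t = from T-∨ (inj₁ t)

    R-+ : ∀ d r v → T (R r v) → T (R (d + r) v)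
    R-+ zero r v t = t
    R-+ (suc d) r v t = R-suc (d + r) v (R-+ d r v t)

    R-suc-mono : ∀ r s → (∀ v → T (R r v) → T (R s v)) → ∀ v → T (R (suc r) v) → T (R (suc s) v)
    R-suc-mono r s r⊆s v t with reachSet-suc-elim r t
    ... | inj₁ tv = R-suc s v (r⊆s v tv)
    ... | inj₂ (g , b , ag , j , tb) = reachSet-step s g (r⊆s b tb) ag j

    Stable-+ : ∀ r → Stable r → ∀ d v → T (R (d + r) v) → T (R r v)
    Stable-+ r st zero v t = t
    Stable-+ r st (suc d) v t = st v (R-suc-mono (d + r) r (Stable-+ r st d) v t)

    grows-or-stabilises : ∀ r → suc r ≤ countF (R r) ⊎ ∃[ j ] j ≤ r × Stable j
    grows-or-stabilises zero = inj₁ (countF-pos (R zero) a (eqB-refl a))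
    grows-or-stabilises (suc r) with grows-or-stabilises r
    ... | inj₂ (j , j≤r , st) = inj₂ (j , m≤n⇒m≤1+n j≤r , st)
    ... | inj₁ r<count with T? (anyF (λ v → R (suc r) v ∧ not (R r v)))
    ...   | yes new with anyF-elim _ new
    ...     | v , tv with to T-∧ tv
    ...       | tsuc , tnot = inj₁ (<-≤-trans (s≤s r<count) (countF-< (R r) (R (suc r)) (R-suc r) v tsuc (T-not⇒¬T tnot)))
    grows-or-stabilises (suc r) | inj₁ _ | no nothing-new = inj₂ (r , n≤1+n r , stable)
      where
      stable : Stable r
      stable v tsuc with T? (R r v)
      ... | yes tr = tr
      ... | no ¬tr = ⊥-elim (nothing-new (anyF-intro _ v (from T-∧ (tsuc , ¬T⇒T-not ¬tr))))

    R-saturates : ∀ r v → T (R r v) → T (R (n G) v)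
    R-saturates r v t with grows-or-stabilises (n G)
    ... | inj₁ too-many = ⊥-elim (<-irrefl refl (≤-trans too-many (countF-≤ (R (n G)))))
    ... | inj₂ (j , j≤n , st) =
      subst (λ s → T (R s v)) (m∸n+n≡m j≤n) (R-+ (n G ∸ j) j v (Stable-+ j st r v (subst (λ s → T (R s v)) (+-comm j r) (R-+ j r v t))))

  sameComp-sound : ∀ {a c} → T (sameComp G allowed a c) → Reach G Allowed a c
  sameComp-sound = reachSet-sound (n G)

  sameComp-complete : ∀ {a c} → Reach G Allowed a c → T (sameComp G allowed a c)
  sameComp-complete {a} {c} r with reachSet-extend zero (eqB-refl a) r
  ... | s , t = Stabilisation.R-saturates a s c t

nodeAllowed : (G : Multigraph) → Fin (n G) → Fin (m G) → Bool
nodeAllowed G x f = not (eqB (proj₁ (ends G f)) x) ∧ not (eqB (proj₂ (ends G f)) x)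

module _ {G : Multigraph} where

  linkComp-sound : ∀ {l a c} → T (sameCompMinusLink G l a c) → Reach G (_≢ l) a c
  linkComp-sound t = Reach-mono not-eqB-sound (sameComp-sound G _ t)

  linkComp-complete : ∀ {l a c} → Reach G (_≢ l) a c → T (sameCompMinusLink G l a c)
  linkComp-complete r = sameComp-complete G _ (Reach-mono eqB-≢ r)

  nodeComp-sound : ∀ {x a c} → T (sameComp G (nodeAllowed G x) a c) → Reach G (Avoids G x) a c
  nodeComp-sound t = Reach-mono (λ t′ → let (p , q) = to T-∧ t′ in not-eqB-sound p , not-eqB-sound q) (sameComp-sound G _ t)

  nodeComp-complete : ∀ {x a c} → Reach G (Avoids G x) a c → T (sameComp G (nodeAllowed G x) a c)
  nodeComp-complete r = sameComp-complete G _ (Reach-mono (λ (p , q) → from T-∧ (eqB-≢ p , eqB-≢ q)) r)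

-- Trees

imageSize : ∀ {N} → (Fin N → Fin N) → ℕ
imageSize lab = countF (λ y → anyF (λ x → eqB (lab x) y))

-- Each allowed edge merges at most two label classes into one.
labelling : ∀ {N} k (es : Fin k → Fin N × Fin N) (allowed : Fin k → Bool)
  → ∃[ lab ] (∀ i → T (allowed i) → lab (proj₁ (es i)) ≡ lab (proj₂ (es i)))
           × N ≤ imageSize lab + countF allowed
labelling zero es allowed =
  (λ x → x) , (λ ()) , ≤-trans (countF-all _ (λ y → anyF-intro _ y (eqB-refl y))) (m≤m+n _ 0)
labelling {N} (suc k) es allowed with labelling k (λ i → es (suc i)) (λ i → allowed (suc i)) | T? (allowed zero)
... | lab , lab-const , N≤ | no ¬t = lab , const , ≤-trans N≤ (+-monoʳ-≤ (imageSize lab) (m≤n+m _ (bit (allowed zero))))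
  where
  const : ∀ i → T (allowed i) → lab (proj₁ (es i)) ≡ lab (proj₂ (es i))
  const zero t = ⊥-elim (¬t t)
  const (suc i) t = lab-const i t
... | lab , lab-const , N≤ | yes t = merged , const , count
  where
  a = proj₁ (es zero)
  b = proj₂ (es zero)
  merge : Fin N → Fin N
  merge y = if eqB y (lab b) then lab a else y
  merged : Fin N → Fin N
  merged x = merge (lab x)
  merge-a : merge (lab a) ≡ lab a
  merge-a with lab a ≟ lab b
  ... | yes _ = refl
  ... | no _ = refl
  merge-b : merge (lab b) ≡ lab a
  merge-b with lab b ≟ lab b
  ... | yes _ = refl
  ... | no b≢b = ⊥-elim (b≢b refl)
  merge-≢ : ∀ {y} → y ≢ lab b → merge y ≡ y
  merge-≢ {y} y≢b with y ≟ lab b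
  ... | yes y≡b = ⊥-elim (y≢b y≡b)
  ... | no _ = refl
  const : ∀ i → T (allowed i) → merged (proj₁ (es i)) ≡ merged (proj₂ (es i))
  const zero _ = trans merge-a (sym merge-b)
  const (suc i) tᵢ = cong merge (lab-const i tᵢ)
  image-kept : ∀ y → y ≢ lab b → T (anyF (λ x → eqB (lab x) y)) → T (anyF (λ x → eqB (merged x) y))
  image-kept y y≢b t with anyF-elim _ t
  ... | x , lx≡y with eqB-sound {a = lab x} {y} lx≡y
  ...   | refl = anyF-intro _ x (subst (λ z → T (eqB z (lab x))) (sym (merge-≢ y≢b)) (eqB-refl (lab x)))
  count : N ≤ imageSize merged + countF allowed
  count = begin
    N                                                           ≤⟨ N≤ ⟩
    imageSize lab + countF (λ i → allowed (suc i))              ≤⟨ +-monoˡ-≤ _ (countF-≤-suc _ _ (lab b) image-kept) ⟩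
    suc (imageSize merged) + countF (λ i → allowed (suc i))     ≡⟨ +-suc (imageSize merged) _ ⟨
    imageSize merged + suc (countF (λ i → allowed (suc i)))     ≤⟨ +-monoʳ-≤ (imageSize merged) (+-monoˡ-≤ _ (bit-mono {true} (λ _ → t))) ⟩
    imageSize merged + countF allowed                           ∎
    where open ≤-Reasoning

module Tree (T₀ : Multigraph) (tree₀ : IsTree T₀) where

  connected : ∀ a b → Reach T₀ U a b
  connected a b = Walk⇒Reach (proj₁ tree₀ a b)

  -- If the ends of l were joined in T₀ − l, then T₀ − l would be connected with m − 1 edges,
  -- and labelling it would give n ≤ 1 + (m − 1).
  link-is-bridge : ∀ l → ¬ Reach T₀ (_≢ l) (proj₁ (ends T₀ l)) (proj₂ (ends T₀ l))
  link-is-bridge l detour = <-irrefl refl (subst (_≤ m T₀) (sym (proj₂ tree₀)) (begin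
    n T₀                              ≤⟨ n≤ ⟩
    imageSize lab + countF allowed    ≤⟨ +-monoˡ-≤ (countF allowed) image-≤-1 ⟩
    suc (countF allowed)              ≤⟨ countF-<-size allowed l (λ t → not-eqB-sound {a = l} t refl) ⟩
    m T₀                              ∎))
    where
    open ≤-Reasoning
    allowed : Fin (m T₀) → Bool
    allowed f = not (eqB f l)
    bypass : ∀ {a b} → Reach T₀ U a b → Reach T₀ (_≢ l) a b
    bypass ε = ε
    bypass (step f _ j ◅ r) with f ≟ l
    ... | yes refl = Reach-along j detour ◅◅ bypass r
    ... | no f≢l = step f f≢l j ◅ bypass r
    labels = labelling (m T₀) (ends T₀) allowed
    lab = proj₁ labels
    n≤ = proj₂ (proj₂ labels)
    lab-step : ∀ {f a b} → f ≢ l → Joins T₀ f a b → lab a ≡ lab b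
    lab-step {f} f≢l (forward refl) = proj₁ (proj₂ labels) f (eqB-≢ f≢l)
    lab-step {f} f≢l (backward refl) = sym (proj₁ (proj₂ labels) f (eqB-≢ f≢l))
    lab-reach : ∀ {a b} → Reach T₀ (_≢ l) a b → lab a ≡ lab b
    lab-reach ε = refl
    lab-reach (step f f≢l j ◅ r) = trans (lab-step f≢l j) (lab-reach r)
    image-≤-1 : imageSize lab ≤ 1
    image-≤-1 = subst (λ c → imageSize lab ≤ suc c) (countF-false {n T₀})
      (countF-≤-suc _ (λ _ → false) (lab (proj₁ (ends T₀ l))) only-one)
      where
      only-one : ∀ y → y ≢ lab (proj₁ (ends T₀ l)) → T (anyF (λ x → eqB (lab x) y)) → T false
      only-one y y≢ t with anyF-elim _ t
      ... | x , lx≡y = y≢ (trans (sym (eqB-sound lx≡y)) (lab-reach (bypass (connected x _))))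

  separating-link : ∀ {a c} → a ≢ c → ∃[ l ] ¬ Reach T₀ (_≢ l) a c
  separating-link {a} {c} a≢c with first-visit a (λ c≡a → a≢c (sym c≡a)) (connected c a)
  ... | inj₁ r = ⊥-elim (Reach-Avoids-≢ (Reach-mono proj₂ r) (λ c≡a → a≢c (sym c≡a)) refl)
  ... | inj₂ (y , r , step f _ j) = f , λ a~c →
    link-is-bridge f (Reach-ends (Joins-sym j) (a~c ◅◅ Reach-mono (avoids⇒≢ ∘ proj₂) r))
    where
    avoids⇒≢ : ∀ {g} → Avoids T₀ a g → g ≢ f
    avoids⇒≢ av refl = proj₂ (Joins-Avoids j av) refl

  reaches-end : ∀ l a → ReachesEndOf T₀ (_≢ l) l a
  reaches-end l a with first-use l (connected a (proj₁ (ends T₀ l)))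
  ... | inj₁ r = inj₁ (Reach-mono proj₂ r)
  ... | inj₂ (inj₁ r) = inj₁ (Reach-mono proj₂ r)
  ... | inj₂ (inj₂ r) = inj₂ (Reach-mono proj₂ r)

  two-of-three : ∀ l a b c → Reach T₀ (_≢ l) a b ⊎ Reach T₀ (_≢ l) a c ⊎ Reach T₀ (_≢ l) b c
  two-of-three l a b c with reaches-end l a | reaches-end l b | reaches-end l c
  ... | inj₁ ra | inj₁ rb | _       = inj₁ (ra ◅◅ Reach-sym rb)
  ... | inj₂ ra | inj₂ rb | _       = inj₁ (ra ◅◅ Reach-sym rb)
  ... | inj₁ ra | inj₂ rb | inj₁ rc = inj₂ (inj₁ (ra ◅◅ Reach-sym rc))
  ... | inj₁ ra | inj₂ rb | inj₂ rc = inj₂ (inj₂ (rb ◅◅ Reach-sym rc))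
  ... | inj₂ ra | inj₁ rb | inj₁ rc = inj₂ (inj₂ (rb ◅◅ Reach-sym rc))
  ... | inj₂ ra | inj₁ rb | inj₂ rc = inj₂ (inj₁ (ra ◅◅ Reach-sym rc))

oneNodeMore : (T₀ : Multigraph) (ends′ : Fin (suc (m T₀)) → Fin (suc (n T₀)) × Fin (suc (n T₀)))
  → (∀ f → proj₁ (ends′ f) ≢ proj₂ (ends′ f)) → Multigraph
oneNodeMore T₀ ends′ noLoop′ = record { n = suc (n T₀) ; m = suc (m T₀) ; ends = ends′ ; noLoop = noLoop′ }

addLeaf : (T₀ : Multigraph) → Fin (n T₀) → Multigraph
addLeaf T₀ x = oneNodeMore T₀ E NL
  where
  E : Fin (suc (m T₀)) → Fin (suc (n T₀)) × Fin (suc (n T₀))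
  E zero = zero , suc x
  E (suc f) = suc (proj₁ (ends T₀ f)) , suc (proj₂ (ends T₀ f))
  NL : ∀ f → proj₁ (E f) ≢ proj₂ (E f)
  NL zero ()
  NL (suc f) eq = noLoop T₀ f (suc-injective eq)

module _ (G : Multigraph) (e : Fin (m G)) where

  subdivide-ends-split : ends (subdivide G e) (suc e) ≡ (suc (proj₁ (ends G e)) , zero)
  subdivide-ends-split with e ≟ e
  ... | yes _ = refl
  ... | no e≢e = ⊥-elim (e≢e refl)

  subdivide-ends-other : ∀ {f} → f ≢ e → ends (subdivide G e) (suc f) ≡ (suc (proj₁ (ends G f)) , suc (proj₂ (ends G f)))
  subdivide-ends-other {f} f≢e with f ≟ e
  ... | yes f≡e = ⊥-elim (f≢e f≡e)
  ... | no _ = refl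

module _ {T₀ : Multigraph} (x : Fin (n T₀)) where

  addLeaf-lift : ∀ {P : Fin (m T₀) → Set} {P′ : Fin (suc (m T₀)) → Set} → (∀ {f} → P f → P′ (suc f))
    → ∀ {a c} → Reach T₀ P a c → Reach (addLeaf T₀ x) P′ (suc a) (suc c)
  addLeaf-lift P⇒P′ = gmap suc λ where
    (step f pf (forward refl))  → step (suc f) (P⇒P′ pf) (forward refl)
    (step f pf (backward refl)) → step (suc f) (P⇒P′ pf) (backward refl)

  addLeaf-attach : ∀ {P′ : Fin (suc (m T₀)) → Set} → P′ zero → Reach (addLeaf T₀ x) P′ (suc x) zero
  addLeaf-attach pz = return (step zero pz (backward refl))

  addLeaf-isTree : IsTree T₀ → IsTree (addLeaf T₀ x)
  addLeaf-isTree tree₀ = (λ u v → Reach⇒Walk (to-leaf u ◅◅ Reach-sym (to-leaf v))) , cong suc (proj₂ tree₀)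
    where
    to-leaf : ∀ u → Reach (addLeaf T₀ x) U u zero
    to-leaf zero = ε
    to-leaf (suc a) = addLeaf-lift (λ _ → tt) (Tree.connected T₀ tree₀ a x) ◅◅ addLeaf-attach tt

module _ {T₀ : Multigraph} (l : Fin (m T₀)) where

  subdivide-lift : ∀ {P : Fin (m T₀) → Set} {P′ : Fin (suc (m T₀)) → Set}
    → (∀ {f} → f ≢ l → P f → P′ (suc f)) → (P l → P′ (suc l) × P′ zero)
    → ∀ {a c} → Reach T₀ P a c → Reach (subdivide T₀ l) P′ (suc a) (suc c)
  subdivide-lift {P} {P′} P⇒P′ via-l = kleisliStar suc lift-step
    where
    lift-step : ∀ {a b} → Step T₀ P a b → Reach (subdivide T₀ l) P′ (suc a) (suc b)
    lift-step (step f pf j) with f ≟ l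
    lift-step (step f pf (forward refl)) | yes refl =
      step (suc l) (proj₁ (via-l pf)) (forward (subdivide-ends-split T₀ l))
      ◅ step zero (proj₂ (via-l pf)) (forward refl) ◅ ε
    lift-step (step f pf (backward refl)) | yes refl =
      step zero (proj₂ (via-l pf)) (backward refl)
      ◅ step (suc l) (proj₁ (via-l pf)) (backward (subdivide-ends-split T₀ l)) ◅ ε
    lift-step (step f pf (forward refl)) | no f≢l =
      return (step (suc f) (P⇒P′ f≢l pf) (forward (subdivide-ends-other T₀ l f≢l)))
    lift-step (step f pf (backward refl)) | no f≢l =
      return (step (suc f) (P⇒P′ f≢l pf) (backward (subdivide-ends-other T₀ l f≢l)))

  subdivide-attach₁ : ∀ {P′ : Fin (suc (m T₀)) → Set} → P′ (suc l)
    → Reach (subdivide T₀ l) P′ (suc (proj₁ (ends T₀ l))) zero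
  subdivide-attach₁ pl = return (step (suc l) pl (forward (subdivide-ends-split T₀ l)))

  subdivide-attach₂ : ∀ {P′ : Fin (suc (m T₀)) → Set} → P′ zero
    → Reach (subdivide T₀ l) P′ (suc (proj₂ (ends T₀ l))) zero
  subdivide-attach₂ pz = return (step zero pz (backward refl))

  subdivide-isTree : IsTree T₀ → IsTree (subdivide T₀ l)
  subdivide-isTree tree₀ = (λ u v → Reach⇒Walk (to-new u ◅◅ Reach-sym (to-new v))) , cong suc (proj₂ tree₀)
    where
    to-new : ∀ u → Reach (subdivide T₀ l) U u zero
    to-new zero = ε
    to-new (suc a) =
      subdivide-lift (λ _ _ → tt) (λ _ → tt , tt) (Tree.connected T₀ tree₀ a (proj₂ (ends T₀ l))) ◅◅ subdivide-attach₂ tt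

-- The decomposition of the subdivided graph

tree : {G : Multigraph} → TreeCutDecomposition G → Multigraph
tree = TreeCutDecomposition.T

liftBag : ∀ {N M} → (Fin N → Fin M) → Fin (suc N) → Fin (suc M)
liftBag bag zero = zero
liftBag bag (suc x) = suc (bag x)

-- adhLink D l and adhNode D b are crossing G (bag D) of the separation relations of T − l, T − b.
crossing : (G : Multigraph) {N : ℕ} → (Fin (n G) → Fin N) → (Fin N → Fin N → Bool) → ℕ
crossing G bag X = countF (λ f → X (bag (proj₁ (ends G f))) (bag (proj₂ (ends G f))))

module _ (G : Multigraph) (e : Fin (m G)) where

  crossing-subdivide : ∀ {N} (bag : Fin (n G) → Fin N) (X : Fin (suc N) → Fin (suc N) → Bool) (Y : Fin N → Fin N → Bool)
    (a b : ℕ) → (∀ y z → T (X (suc y) (suc z)) → T (Y y z))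
    → a + (bit (X zero (suc (bag (proj₂ (ends G e))))) + bit (X (suc (bag (proj₁ (ends G e)))) zero))
      ≤ b + bit (Y (bag (proj₁ (ends G e))) (bag (proj₂ (ends G e))))
    → a + crossing (subdivide G e) (liftBag bag) X ≤ b + crossing G bag Y
  crossing-subdivide {N} bag X Y a b X⇒Y new-edges = +-cancelʳ-≤ (bit (q e)) _ _ (begin
    a + (x₀ + countF p) + bit (q e)      ≡⟨ shuffle₁ a x₀ (countF p) (bit (q e)) ⟩
    (countF p + bit (q e)) + (a + x₀)    ≤⟨ +-monoˡ-≤ (a + x₀) (countF-except p q e p⇒q) ⟩
    (countF q + bit (p e)) + (a + x₀)    ≡⟨ shuffle₂ (countF q) (bit (p e)) a x₀ ⟩
    countF q + (a + (x₀ + bit (p e)))    ≤⟨ +-monoʳ-≤ (countF q) (subst (λ s → a + (x₀ + bit s) ≤ b + bit (q e)) (sym p-split) new-edges) ⟩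
    countF q + (b + bit (q e))           ≡⟨ shuffle₃ (countF q) b (bit (q e)) ⟩
    b + countF q + bit (q e)             ∎)
    where
    open ≤-Reasoning
    cut : Fin (suc (n G)) × Fin (suc (n G)) → Bool
    cut (y , z) = X (liftBag bag y) (liftBag bag z)
    x₀ = bit (X zero (suc (bag (proj₂ (ends G e)))))
    p q : Fin (m G) → Bool
    p f = cut (ends (subdivide G e) (suc f))
    q f = Y (bag (proj₁ (ends G f))) (bag (proj₂ (ends G f)))
    p-split : p e ≡ X (suc (bag (proj₁ (ends G e)))) zero
    p-split = cong cut (subdivide-ends-split G e)
    p⇒q : ∀ f → f ≢ e → T (p f) → T (q f)
    p⇒q f f≢e t = X⇒Y _ _ (subst (T ∘ cut) (subdivide-ends-other G e f≢e) t)
    shuffle₁ : ∀ a x c d → a + (x + c) + d ≡ (c + d) + (a + x)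
    shuffle₁ = solve-∀
    shuffle₂ : ∀ c d a x → (c + d) + (a + x) ≡ c + (a + (x + d))
    shuffle₂ = solve-∀
    shuffle₃ : ∀ c b d → c + (b + d) ≡ b + c + d
    shuffle₃ = solve-∀

maxF-ub : (f : Fin k → ℕ) (i : Fin k) → f i ≤ maxF f
maxF-ub f zero = m≤m⊔n _ _
maxF-ub f (suc i) = ≤-trans (maxF-ub (λ j → f (suc j)) i) (m≤n⊔m (f zero) _)

maxF-lub : (f : Fin k → ℕ) {K : ℕ} → (∀ i → f i ≤ K) → maxF f ≤ K
maxF-lub {zero} f f≤K = z≤n
maxF-lub {suc k} f f≤K = ⊔-lub (f≤K zero) (maxF-lub (λ i → f (suc i)) (λ i → f≤K (suc i)))

module _ {G : Multigraph} (D : TreeCutDecomposition G) where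

  adhLink≤width : ∀ l → adhLink D l ≤ width D
  adhLink≤width l = ≤-trans (maxF-ub (adhLink D) l) (m≤m⊔n _ _)

  nodeLoad≤width : ∀ b → bagSize D b + adhNode D b ≤ width D
  nodeLoad≤width b = ≤-trans (maxF-ub (λ b → bagSize D b + adhNode D b) b) (m≤n⊔m _ _)

  width-≤ : ∀ {K} → (∀ l → adhLink D l ≤ K) → (∀ b → bagSize D b + adhNode D b ≤ K) → width D ≤ K
  width-≤ links nodes = ⊔-lub (maxF-lub (adhLink D) links) (maxF-lub (λ b → bagSize D b + adhNode D b) nodes)

separated-mono : ∀ c₁ c₂ {s s′} → (T s → T s′) → T (c₁ ∧ (c₂ ∧ not s′)) → T (c₁ ∧ (c₂ ∧ not s))
separated-mono true true {false} s⇒s′ _ = tt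
separated-mono true true {true} s⇒s′ t = T-not⇒¬T t (s⇒s′ tt)

-- c₁, c₂ : the bags of v, w differ from the removed node; s₁, s₂, s : u–w, v–u, v–w stay joined.
subdivided-edge-bits : ∀ {c₁ c₂ s₁ s₂ s}
  → (¬ T c₁ → T c₂ → T s₁) → (¬ T c₂ → T c₁ → T s₂)
  → (T c₁ → T c₂ → T s → T s₁ × T s₂) → (T c₁ → T c₂ → T s₁ ⊎ T s₂)
  → bit (c₂ ∧ not s₁) + bit (c₁ ∧ not s₂) ≤ bit (c₁ ∧ (c₂ ∧ not s))
subdivided-edge-bits {false} {false} _ _ _ _ = z≤n
subdivided-edge-bits {false} {true} {s₁} only₂ _ _ _ with s₁ | only₂ (λ ()) tt
... | true | _ = z≤n
subdivided-edge-bits {true} {false} {s₂ = s₂} _ only₁ _ _ with s₂ | only₁ (λ ()) tt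
... | true | _ = z≤n
subdivided-edge-bits {true} {true} {s₁} {s₂} {true} _ _ both _ with s₁ | s₂ | both tt tt tt
... | true | true | _ = z≤n
subdivided-edge-bits {true} {true} {s₁} {s₂} {false} _ _ _ one with s₁ | s₂ | one tt tt
... | true | s₂′ | _ = bit-≤-1 (not s₂′)
... | false | true | _ = s≤s z≤n
... | false | false | inj₁ ()
... | false | false | inj₂ ()

module LiftedDecomposition {G : Multigraph} (e : Fin (m G)) (D : TreeCutDecomposition G)
  (ends′ : Fin (suc (m (tree D))) → Fin (suc (n (tree D))) × Fin (suc (n (tree D))))
  (noLoop′ : ∀ f → proj₁ (ends′ f) ≢ proj₂ (ends′ f))
  (tree′ : IsTree (oneNodeMore (tree D) ends′ noLoop′))
  where

  T₀ T′ : Multigraph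
  T₀ = tree D
  T′ = oneNodeMore T₀ ends′ noLoop′

  D′ : TreeCutDecomposition (subdivide G e)
  D′ = record { T = T′ ; isTree = tree′ ; bag = liftBag (bag D) }

  bv bw : Fin (n T₀)
  bv = bag D (proj₁ (ends G e))
  bw = bag D (proj₂ (ends G e))

  adhLink-≤ : ∀ L′ L
    → (∀ {y z} → Reach T₀ (_≢ L) y z → Reach T′ (_≢ L′) (suc y) (suc z))
    → (Reach T₀ (_≢ L) bv bw → Reach T′ (_≢ L′) zero (suc bw) × Reach T′ (_≢ L′) (suc bv) zero)
    → Reach T′ (_≢ L′) zero (suc bw) ⊎ Reach T′ (_≢ L′) (suc bv) zero
    → adhLink D′ L′ ≤ adhLink D L
  adhLink-≤ L′ L lift both one = crossing-subdivide G e (bag D)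
    (λ a c → not (sameCompMinusLink T′ L′ a c)) (λ a c → not (sameCompMinusLink T₀ L a c)) 0 0
    (λ y z → separated-mono true true (linkComp-complete ∘ lift ∘ linkComp-sound))
    (subdivided-edge-bits (λ ¬t → ⊥-elim (¬t tt)) (λ ¬t → ⊥-elim (¬t tt))
      (λ _ _ t → let (r₁ , r₂) = both (linkComp-sound t) in linkComp-complete r₁ , linkComp-complete r₂)
      (λ _ _ → Data.Sum.map linkComp-complete linkComp-complete one))

  module _ (b : Fin (n T₀)) where

    private
      R′ : Fin (n T′) → Fin (n T′) → Set
      R′ = Reach T′ (Avoids T′ (suc b))

    adhNode-≤ : (∀ {y z} → Reach T₀ (Avoids T₀ b) y z → R′ (suc y) (suc z))
      → (bv ≡ b → bw ≢ b → R′ zero (suc bw))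
      → (bw ≡ b → bv ≢ b → R′ (suc bv) zero)
      → (bv ≢ b → bw ≢ b → Reach T₀ (Avoids T₀ b) bv bw → R′ zero (suc bw) × R′ (suc bv) zero)
      → (bv ≢ b → bw ≢ b → R′ zero (suc bw) ⊎ R′ (suc bv) zero)
      → adhNode D′ (suc b) ≤ adhNode D b
    adhNode-≤ lift at-v at-w both one = crossing-subdivide G e (bag D)
      (diffCompMinusNode T′ (suc b)) (diffCompMinusNode T₀ b) 0 0
      (λ y z → separated-mono (not (eqB y b)) (not (eqB z b)) (nodeComp-complete ∘ lift ∘ nodeComp-sound))
      (subdivided-edge-bits
        (λ ¬c₁ c₂ → nodeComp-complete (at-v (eqB-complete ¬c₁) (not-eqB-sound c₂)))
        (λ ¬c₂ c₁ → nodeComp-complete (at-w (eqB-complete ¬c₂) (not-eqB-sound c₁)))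
        (λ c₁ c₂ t → let (r₁ , r₂) = both (not-eqB-sound c₁) (not-eqB-sound c₂) (nodeComp-sound t)
                     in nodeComp-complete r₁ , nodeComp-complete r₂)
        (λ c₁ c₂ → Data.Sum.map nodeComp-complete nodeComp-complete (one (not-eqB-sound c₁) (not-eqB-sound c₂))))

module LeafCase {G : Multigraph} (e : Fin (m G)) (D : TreeCutDecomposition G)
  (same-bag : bag D (proj₁ (ends G e)) ≡ bag D (proj₂ (ends G e))) where

  open LiftedDecomposition e D (ends (addLeaf (tree D) (bag D (proj₁ (ends G e)))))
    (noLoop (addLeaf (tree D) (bag D (proj₁ (ends G e))))) (addLeaf-isTree (bag D (proj₁ (ends G e))) (isTree D))

  private
    lift : ∀ {P : Fin (m T₀) → Set} {P′ : Fin (m T′) → Set} → (∀ {f} → P f → P′ (suc f))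
         → ∀ {a c} → Reach T₀ P a c → Reach T′ P′ (suc a) (suc c)
    lift = addLeaf-lift bv

    connected : ∀ a c → Reach T₀ U a c
    connected = Tree.connected T₀ (isTree D)

  two≤width : 2 ≤ width D
  two≤width = begin
    2                           ≤⟨ countF-two (λ x → eqB (bag D x) bv) (noLoop G e) (eqB-refl bv)
                                     (subst (λ z → T (eqB z bv)) same-bag (eqB-refl bv)) ⟩
    bagSize D bv                ≤⟨ m≤m+n _ _ ⟩
    bagSize D bv + adhNode D bv ≤⟨ nodeLoad≤width D bv ⟩
    width D                     ∎
    where open ≤-Reasoning

  leaf-link≤2 : adhLink D′ zero ≤ 2
  leaf-link≤2 = subst (λ c → adhLink D′ zero ≤ 2 + c) (countF-false {m G})
    (crossing-subdivide G e (bag D) (λ a c → not (sameCompMinusLink T′ zero a c)) (λ _ _ → false) 0 2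
      (λ y z t → T-not⇒¬T t (linkComp-complete (lift (λ _ ()) (connected y z))))
      (+-mono-≤ (bit-≤-1 (not (sameCompMinusLink T′ zero zero (suc bw)))) (bit-≤-1 (not (sameCompMinusLink T′ zero (suc bv) zero)))))

  leaf-adhesion≤0 : adhNode D′ zero ≤ 0
  leaf-adhesion≤0 = subst (adhNode D′ zero ≤_) (countF-false {m G})
    (crossing-subdivide G e (bag D) (diffCompMinusNode T′ zero) (λ _ _ → false) 0 0
      (λ y z t → T-not⇒¬T t (nodeComp-complete (lift (λ _ → (λ ()) , (λ ())) (connected y z))))
      z≤n)

  private
    leaf-joins-ends : ∀ {P′ : Fin (m T′) → Set} → P′ zero → Reach T′ P′ zero (suc bw) × Reach T′ P′ (suc bv) zero
    leaf-joins-ends pz = subst (λ z → Reach T′ _ zero (suc z)) same-bag (Reach-sym (addLeaf-attach bv pz)) , addLeaf-attach bv pz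

  adhLink′≤width : ∀ L → adhLink D′ L ≤ width D
  adhLink′≤width zero = ≤-trans leaf-link≤2 two≤width
  adhLink′≤width (suc l) = ≤-trans
    (adhLink-≤ (suc l) l (lift (λ f≢l eq → f≢l (suc-injective eq))) (λ _ → joined) (inj₁ (proj₁ joined)))
    (adhLink≤width D l)
    where joined = leaf-joins-ends {_≢ suc l} (λ ())

  nodeLoad′≤width : ∀ b → bagSize D′ b + adhNode D′ b ≤ width D
  nodeLoad′≤width zero = ≤-trans
    (subst (λ s → suc s + adhNode D′ zero ≤ 2) (sym (countF-false {n G})) (s≤s (≤-trans leaf-adhesion≤0 z≤n)))
    two≤width
  nodeLoad′≤width (suc b) = ≤-trans (+-monoʳ-≤ (bagSize D b) (adhNode-≤ b
      (lift (λ (p≢b , q≢b) → (λ eq → p≢b (suc-injective eq)) , (λ eq → q≢b (suc-injective eq))))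
      (λ bv≡b bw≢b → ⊥-elim (bw≢b (trans (sym same-bag) bv≡b)))
      (λ bw≡b bv≢b → ⊥-elim (bv≢b (trans same-bag bw≡b)))
      (λ bv≢b _ _ → joined bv≢b)
      (λ bv≢b _ → inj₂ (proj₂ (joined bv≢b)))))
    (nodeLoad≤width D b)
    where joined = λ bv≢b → leaf-joins-ends {Avoids T′ (suc b)} ((λ ()) , (λ eq → bv≢b (suc-injective eq)))

  no-wider-decomposition : Σ (TreeCutDecomposition (subdivide G e)) (λ D″ → width D″ ≤ width D)
  no-wider-decomposition = D′ , width-≤ D′ adhLink′≤width nodeLoad′≤width

module SplitCase {G : Multigraph} (e : Fin (m G)) (D : TreeCutDecomposition G) (l : Fin (m (tree D)))
  (separates : ¬ Reach (tree D) (_≢ l) (bag D (proj₁ (ends G e))) (bag D (proj₂ (ends G e)))) where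

  open LiftedDecomposition e D (ends (subdivide (tree D) l)) (noLoop (subdivide (tree D) l)) (subdivide-isTree l (isTree D))
  open Tree T₀ (isTree D) using (reaches-end; two-of-three)

  private
    p q : Fin (n T₀)
    p = proj₁ (ends T₀ l)
    q = proj₂ (ends T₀ l)

    lift : ∀ {P : Fin (m T₀) → Set} {P′ : Fin (m T′) → Set}
      → (∀ {f} → f ≢ l → P f → P′ (suc f)) → (P l → P′ (suc l) × P′ zero)
      → ∀ {a c} → Reach T₀ P a c → Reach T′ P′ (suc a) (suc c)
    lift = subdivide-lift l

    to-new : ∀ {P : Fin (m T₀) → Set} {P′ : Fin (m T′) → Set} {y}
      → (∀ {a c} → Reach T₀ P a c → Reach T′ P′ (suc a) (suc c)) → ReachesEndOf T₀ P l y
      → (Reach T₀ P y p → P′ (suc l)) → (Reach T₀ P y q → P′ zero) → Reach T′ P′ (suc y) zero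
    to-new lift′ (inj₁ r) via-p _ = lift′ r ◅◅ subdivide-attach₁ l (via-p r)
    to-new lift′ (inj₂ r) _ via-q = lift′ r ◅◅ subdivide-attach₂ l (via-q r)

    one-side : ∀ {P′ : Fin (m T′) → Set} L x → (∀ {y z} → Reach T₀ (_≢ L) y z → Reach T′ P′ (suc y) (suc z))
      → Reach T′ P′ (suc x) zero → (Reach T₀ (_≢ L) bv bw → Reach T′ P′ zero (suc bw))
      → Reach T′ P′ zero (suc bw) ⊎ Reach T′ P′ (suc bv) zero
    one-side L x lift′ x~new joined with two-of-three L bv bw x
    ... | inj₁ r = inj₁ (joined r)
    ... | inj₂ (inj₁ r) = inj₂ (lift′ r ◅◅ x~new)
    ... | inj₂ (inj₂ r) = inj₁ (Reach-sym (lift′ r ◅◅ x~new))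

    avoids-lifted : ∀ {f b} → f ≢ l → Avoids T₀ b f → Avoids T′ (suc b) (suc f)
    avoids-lifted {f} f≢l (p≢b , q≢b) rewrite subdivide-ends-other T₀ l f≢l =
      (λ eq → p≢b (suc-injective eq)) , (λ eq → q≢b (suc-injective eq))

    new-avoided : ∀ {f} → f ≢ l → Avoids T′ zero (suc f)
    new-avoided {f} f≢l rewrite subdivide-ends-other T₀ l f≢l = (λ ()) , (λ ())

    split-avoids : ∀ {b} → p ≢ b → Avoids T′ (suc b) (suc l)
    split-avoids p≢b rewrite subdivide-ends-split T₀ l = (λ eq → p≢b (suc-injective eq)) , (λ ())

  adhLink′≤width : ∀ L → adhLink D′ L ≤ width D
  adhLink′≤width zero = ≤-trans
    (adhLink-≤ zero l lift₀ (⊥-elim ∘ separates) (one-side l p lift₀ (subdivide-attach₁ l (λ ())) (⊥-elim ∘ separates)))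
    (adhLink≤width D l)
    where
    lift₀ : ∀ {y z} → Reach T₀ (_≢ l) y z → Reach T′ (_≢ zero) (suc y) (suc z)
    lift₀ = lift (λ _ _ ()) (λ l≢l → ⊥-elim (l≢l refl))
  adhLink′≤width (suc L) with L ≟ l
  ... | yes refl = ≤-trans
    (adhLink-≤ (suc l) l liftₗ (⊥-elim ∘ separates) (one-side l q liftₗ (subdivide-attach₂ l (λ ())) (⊥-elim ∘ separates)))
    (adhLink≤width D l)
    where
    liftₗ : ∀ {y z} → Reach T₀ (_≢ l) y z → Reach T′ (_≢ suc l) (suc y) (suc z)
    liftₗ = lift (λ f≢l _ eq → f≢l (suc-injective eq)) (λ l≢l → ⊥-elim (l≢l refl))
  ... | no L≢l = ≤-trans
    (adhLink-≤ (suc L) L liftₒ joined (one-side L p liftₒ p~new (proj₁ ∘ joined)))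
    (adhLink≤width D L)
    where
    liftₒ : ∀ {y z} → Reach T₀ (_≢ L) y z → Reach T′ (_≢ suc L) (suc y) (suc z)
    liftₒ = lift (λ _ f≢L eq → f≢L (suc-injective eq)) (λ l≢L → (λ eq → l≢L (suc-injective eq)) , (λ ()))
    p~new : Reach T′ (_≢ suc L) (suc p) zero
    p~new = subdivide-attach₁ l (λ eq → L≢l (sym (suc-injective eq)))
    joined : Reach T₀ (_≢ L) bv bw → Reach T′ (_≢ suc L) zero (suc bw) × Reach T′ (_≢ suc L) (suc bv) zero
    joined r with first-use l r
    ... | inj₁ r′ = ⊥-elim (separates (Reach-mono proj₂ r′))
    ... | inj₂ end = Reach-sym bv~new ◅◅ liftₒ r , bv~new
      where
      bv~new = to-new liftₒ (Data.Sum.map (Reach-mono proj₁) (Reach-mono proj₁) end)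
                 (λ _ eq → L≢l (sym (suc-injective eq))) (λ _ ())

  nodeLoad′≤width : ∀ b → bagSize D′ b + adhNode D′ b ≤ width D
  nodeLoad′≤width zero = ≤-trans
    (subst (λ s → suc s + adhNode D′ zero ≤ adhLink D l) (sym (countF-false {n G}))
      (crossing-subdivide G e (bag D) (diffCompMinusNode T′ zero) (λ a c → not (sameCompMinusLink T₀ l a c)) 1 0
        (λ y z → separated-mono true true (nodeComp-complete ∘ liftₙ ∘ linkComp-sound))
        (bit-mono {true} (λ _ → ¬T⇒T-not (separates ∘ linkComp-sound)))))
    (adhLink≤width D l)
    where
    liftₙ : ∀ {y z} → Reach T₀ (_≢ l) y z → Reach T′ (Avoids T′ zero) (suc y) (suc z)
    liftₙ = lift (λ f≢l _ → new-avoided f≢l) (λ l≢l → ⊥-elim (l≢l refl))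
  nodeLoad′≤width (suc b) = ≤-trans (+-monoʳ-≤ (bagSize D b) (adhNode-≤ b liftᵦ at-v at-w joined one))
                                (nodeLoad≤width D b)
    where
    R′ : Fin (n T′) → Fin (n T′) → Set
    R′ = Reach T′ (Avoids T′ (suc b))
    liftᵦ : ∀ {y z} → Reach T₀ (Avoids T₀ b) y z → R′ (suc y) (suc z)
    liftᵦ = lift avoids-lifted (λ (p≢b , q≢b) → split-avoids p≢b , ((λ ()) , (λ eq → q≢b (suc-injective eq))))
    to-newᵦ : ∀ {y} → y ≢ b → ReachesEndOf T₀ (Avoids T₀ b) l y → R′ (suc y) zero
    to-newᵦ y≢b end = to-new liftᵦ end (λ r → split-avoids (Reach-Avoids-≢ r y≢b))
                                      (λ r → (λ ()) , (λ eq → Reach-Avoids-≢ r y≢b (suc-injective eq)))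
    towards-new : ∀ {y} → y ≢ b → R′ (suc y) zero ⊎ Reach T₀ (_≢ l) y b
    towards-new y≢b with first-visit-end b l y≢b (reaches-end l (_))
    ... | inj₁ end = inj₁ (to-newᵦ y≢b (Data.Sum.map (Reach-mono proj₂) (Reach-mono proj₂) end))
    ... | inj₂ r = inj₂ r
    at-v : bv ≡ b → bw ≢ b → R′ zero (suc bw)
    at-v refl bw≢b with towards-new bw≢b
    ... | inj₁ r = Reach-sym r
    ... | inj₂ r = ⊥-elim (separates (Reach-sym r))
    at-w : bw ≡ b → bv ≢ b → R′ (suc bv) zero
    at-w refl bv≢b with towards-new bv≢b
    ... | inj₁ r = r
    ... | inj₂ r = ⊥-elim (separates r)
    joined : bv ≢ b → bw ≢ b → Reach T₀ (Avoids T₀ b) bv bw → R′ zero (suc bw) × R′ (suc bv) zero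
    joined bv≢b _ r with first-use l r
    ... | inj₁ r′ = ⊥-elim (separates (Reach-mono proj₂ r′))
    ... | inj₂ end = Reach-sym bv~new ◅◅ liftᵦ r , bv~new
      where bv~new = to-newᵦ bv≢b (Data.Sum.map (Reach-mono proj₁) (Reach-mono proj₁) end)
    one : bv ≢ b → bw ≢ b → R′ zero (suc bw) ⊎ R′ (suc bv) zero
    one bv≢b bw≢b with towards-new bw≢b | towards-new bv≢b
    ... | inj₁ r | _ = inj₁ (Reach-sym r)
    ... | inj₂ _ | inj₁ r = inj₂ r
    ... | inj₂ rw | inj₂ rv = ⊥-elim (separates (rv ◅◅ Reach-sym rw))

  no-wider-decomposition : Σ (TreeCutDecomposition (subdivide G e)) (λ D″ → width D″ ≤ width D)
  no-wider-decomposition = D′ , width-≤ D′ adhLink′≤width nodeLoad′≤width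

subdivide-decomposition : (G : Multigraph) (e : Fin (m G)) (D : TreeCutDecomposition G)
  → Σ (TreeCutDecomposition (subdivide G e)) (λ D′ → width D′ ≤ width D)
subdivide-decomposition G e D with bag D (proj₁ (ends G e)) ≟ bag D (proj₂ (ends G e))
... | yes same = LeafCase.no-wider-decomposition e D same
... | no differ with Tree.separating-link (tree D) (isTree D) differ
...   | l , separates = SplitCase.no-wider-decomposition e D l separates

mainTheorem15 : (G : Multigraph) → Connected G → (e : Fin (m G)) → (k k′ : ℕ)
    → IsScw G k → IsScw (subdivide G e) k′ → k′ ≤ k
mainTheorem15 G _ e k k′ ((D , width≡k) , _) (_ , minimal′) =
  ≤-trans (minimal′ D′) (subst (width D′ ≤_) width≡k D′≤D)
  where
  D′ = proj₁ (subdivide-decomposition G e D)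
  D′≤D = proj₂ (subdivide-decomposition G e D)
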